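{- Let $\lambda$ be a partition and evaluate the word $M(\lambda)$ as a product of $3\times 3$ integer matrices by substituting \[ X=\begin{bmatrix}1&0&0\\0&1&1\\0&0&1\end{bmatrix},\qquad Y=\begin{bmatrix}1&1&0\\0&1&0\\0&0&1\end{bmatrix}. \] Then \[ M(\lambda)=\begin{bmatrix}1&\lambda_1&|\lambda|\\0&1&\ell(\lambda)\\0&0&1\end{bmatrix}. \]
   Context: A partition $\lambda=(\lambda_1,\dots,\lambda_\ell)$ is a finite weakly decreasing sequence of positive integers; $\ell(\lambda)=\ell$ is its length, $|\lambda|=\sum_i\lambda_i$ its size, and for the empty partition $\lambda_1:=0$. The $(i,j)$-hook length $h_{i,j}(\lambda)$ is the number of cells $(a,b)$ of the Young diagram $\{(a,b):1\le a\le\ell,\ 1\le b\le\lambda_a\}$ with ($a=i$, $b\ge j$) or ($a\ge i$, $b=j$). The partition sequence $M(\lambda)$ is the word in letters $X,Y$ of length $h_{1,1}(\lambda)+1$ whose $t$-th letter is $X$ if $t=h_{k,1}(\lambda)+1$ for some $k$ and $Y$ otherwise; $M(())$ is the empty word. Equivalently $M(\lambda)=Y^{\lambda_\ell}XY^{\lambda_{\ell-1}-\lambda_\ell}X\cdots Y^{\lambda_1-\lambda_2}X$. A word $w_1w_2\cdots w_m$ is evaluated as the matrix product $W_1W_2\cdots W_m$ (in this order), where $W_t$ is the matrix substituted for the letter $w_t$; the empty word evaluates to the identity matrix. -}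

module Defs where

open import Data.Nat using (ℕ; zero; suc; _+_; _∸_; _≤_; _≥_; _<_; _≡ᵇ_)
open import Data.Integer as ℤ using (ℤ)
open import Data.Fin using (Fin; zero; suc)
open import Data.List using (List; []; _∷_; length; map; upTo)
open import Data.Bool.ListAction using (any)
open import Data.List.Relation.Unary.All using (All)
open import Data.List.Relation.Unary.Linked using (Linked)
open import Data.Bool using (Bool; true; false; if_then_else_)
open import Data.Product using (_×_)

IsPartition : List ℕ → Set
IsPartition λs = All (λ x → 1 ≤ x) λs × Linked _≥_ λs

largestPart : List ℕ → ℕ
largestPart []      = 0
largestPart (x ∷ _) = x

-- λ_i (1-indexed), 0 outside the range
part : List ℕ → ℕ → ℕ
part []       _             = 0
part (x ∷ _)  1             = x
part (_ ∷ xs) (suc (suc i)) = part xs (suc i)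
part (_ ∷ _)  zero          = 0

hook1 : List ℕ → ℕ → ℕ
hook1 λs k = part λs k + (length λs ∸ k)

data Letter : Set where
  X Y : Letter

letterAt : List ℕ → ℕ → Letter
letterAt λs t =
  if any (λ k → t ≡ᵇ (hook1 λs (suc k) + 1)) (upTo (length λs)) then X else Y

M : List ℕ → List Letter
M []         = []
M λs@(_ ∷ _) = map (λ t → letterAt λs (suc t)) (upTo (hook1 λs 1 + 1))

Mat3 : Set
Mat3 = Fin 3 → Fin 3 → ℤ

_⊗_ : Mat3 → Mat3 → Mat3
(A ⊗ B) i j = A i zero ℤ.* B zero j ℤ.+ (A i (suc zero) ℤ.* B (suc zero) j ℤ.+ A i (suc (suc zero)) ℤ.* B (suc (suc zero)) j)

mat : ℤ → ℤ → ℤ → ℤ → ℤ → ℤ → ℤ → ℤ → ℤ → Mat3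
mat a b c d e f g h i zero zero = a
mat a b c d e f g h i zero (suc zero) = b
mat a b c d e f g h i zero (suc (suc zero)) = c
mat a b c d e f g h i (suc zero) zero = d
mat a b c d e f g h i (suc zero) (suc zero) = e
mat a b c d e f g h i (suc zero) (suc (suc zero)) = f
mat a b c d e f g h i (suc (suc zero)) zero = g
mat a b c d e f g h i (suc (suc zero)) (suc zero) = h
mat a b c d e f g h i (suc (suc zero)) (suc (suc zero)) = i

Xmat : Mat3
Xmat = mat (ℤ.+ 1) (ℤ.+ 0) (ℤ.+ 0)
           (ℤ.+ 0) (ℤ.+ 1) (ℤ.+ 1)
           (ℤ.+ 0) (ℤ.+ 0) (ℤ.+ 1)

Ymat : Mat3
Ymat = mat (ℤ.+ 1) (ℤ.+ 1) (ℤ.+ 0)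
           (ℤ.+ 0) (ℤ.+ 1) (ℤ.+ 0)
           (ℤ.+ 0) (ℤ.+ 0) (ℤ.+ 1)

letterMat : Letter → Mat3
letterMat X = Xmat
letterMat Y = Ymat

I₃ : Mat3
I₃ = mat (ℤ.+ 1) (ℤ.+ 0) (ℤ.+ 0)
         (ℤ.+ 0) (ℤ.+ 1) (ℤ.+ 0)
         (ℤ.+ 0) (ℤ.+ 0) (ℤ.+ 1)

eval : List Letter → Mat3
eval []       = I₃
eval (w ∷ ws) = letterMat w ⊗ eval ws

{-# OPTIONS --safe #-}
-- X and Y are the unitriangular matrices of (0,1,0) and (1,0,0) in the Heisenberg monoid
-- (a,b,c)(a′,b′,c′) = (a+a′, b+b′, c+ab′+c′), so a word evaluates to the unitriangular matrix
-- of (number of Y, number of X, number of pairs Y before X). Deleting the first row of λ,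
-- M(λ) = M(λ₂,…,λ_ℓ) Y^(λ₁−λ₂) X, and the three counts follow by induction on ℓ.
module Submission where

open import Defs
open import Data.Nat using (ℕ)
open import Data.Integer using (+_)
open import Data.List using (List; length)
open import Data.Nat.ListAction using (sum)
open import Data.Fin using (Fin)
open import Relation.Binary.PropositionalEquality using (_≡_)

open import Data.Nat using (zero; suc; _+_; _*_; _∸_; _≤_; _<_; _≥_; _≟_; _≡ᵇ_; z≤n; s≤s; z<s; s<s)
open import Data.Nat.Properties
open import Algebra.Properties.CommutativeSemigroup +-commutativeSemigroup
  using (xy∙z≈xz∙y; xy∙z≈yz∙x)
open import Data.Nat.Tactic.RingSolver using (solve-∀; solve)
import Data.Integer as ℤ
open import Data.Integer.Properties using (pos-+; pos-*)
open import Data.Fin using (zero; suc)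
open import Data.List using ([]; _∷_; _++_; _∷ʳ_; map; upTo; applyUpTo; replicate)
open import Data.List.Properties using (map-upTo; map-applyUpTo; applyUpTo-∷ʳ)
open import Data.List.Relation.Unary.Linked as Linked using (Linked)
open import Data.Bool using (Bool; true; false; _∨_; if_then_else_)
open import Data.Bool.ListAction using (or; any)
open import Data.Product using (_×_; _,_)
open import Function using (_∘_)
open import Level using (Level)
open import Relation.Nullary.Decidable using (dec-true; dec-false)
open import Relation.Binary.PropositionalEquality
  using (refl; sym; trans; cong; cong₂; _≢_; module ≡-Reasoning)

open ≡-Reasoning

private
  variable
    ℓ : Level
    A : Set ℓ

_≈_ : Mat3 → Mat3 → Set
A ≈ B = ∀ i j → A i j ≡ B i j

⊗-congʳ : ∀ A {B B′} → B ≈ B′ → (A ⊗ B) ≈ (A ⊗ B′)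
⊗-congʳ A {B} {B′} B≈B′ i j
  rewrite B≈B′ zero j | B≈B′ (suc zero) j | B≈B′ (suc (suc zero)) j = refl

Heisenberg : Set
Heisenberg = ℕ × ℕ × ℕ

_∙_ : Heisenberg → Heisenberg → Heisenberg
(a , b , c) ∙ (a′ , b′ , c′) = a + a′ , b + b′ , c + a * b′ + c′

ε : Heisenberg
ε = 0 , 0 , 0

∙-assoc : ∀ p q r → (p ∙ q) ∙ r ≡ p ∙ (q ∙ r)
∙-assoc (a , b , c) (a′ , b′ , c′) (a″ , b″ , c″) =
  cong₂ _,_ (+-assoc a a′ a″) (cong₂ _,_ (+-assoc b b′ b″) (corner a a′ b′ b″ c c′ c″))
  where
  corner : ∀ a a′ b′ b″ c c′ c″ →
    c + a * b′ + c′ + (a + a′) * b″ + c″ ≡ c + a * (b′ + b″) + (c′ + a′ * b″ + c″)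
  corner = solve-∀

unitriangular : Heisenberg → Mat3
unitriangular (a , b , c) = mat (+ 1) (+ a) (+ c)
                                (+ 0) (+ 1) (+ b)
                                (+ 0) (+ 0) (+ 1)

pos-dot-product : ∀ n p q r s u v → n ≡ p * q + (r * s + u * v) →
  + n ≡ + p ℤ.* + q ℤ.+ (+ r ℤ.* + s ℤ.+ + u ℤ.* + v)
pos-dot-product n p q r s u v n≡ = begin
  + n                                           ≡⟨ cong +_ n≡ ⟩
  + (p * q + (r * s + u * v))                   ≡⟨ pos-+ (p * q) (r * s + u * v) ⟩
  + (p * q) ℤ.+ + (r * s + u * v)               ≡⟨ cong (ℤ._+_ (+ (p * q))) (pos-+ (r * s) (u * v)) ⟩
  + (p * q) ℤ.+ (+ (r * s) ℤ.+ + (u * v))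
    ≡⟨ cong₂ ℤ._+_ (pos-* p q) (cong₂ ℤ._+_ (pos-* r s) (pos-* u v)) ⟩
  + p ℤ.* + q ℤ.+ (+ r ℤ.* + s ℤ.+ + u ℤ.* + v) ∎

-- The entry n is passed explicitly so that the ring solver sees a normalised goal.
unitriangular-∙ : ∀ p q → unitriangular (p ∙ q) ≈ (unitriangular p ⊗ unitriangular q)
unitriangular-∙ (a , b , c) (a′ , b′ , c′) = λ where
  zero             zero             → pos-dot-product 1 1 1  a 0  c 0 (solve (a ∷ c ∷ []))
  zero             (suc zero)       → pos-dot-product (a + a′) 1 a′ a 1  c 0 (solve (a ∷ a′ ∷ c ∷ []))
  zero             (suc (suc zero)) → pos-dot-product (c + a * b′ + c′) 1 c′ a b′ c 1
                                          (solve (a ∷ b′ ∷ c ∷ c′ ∷ []))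
  (suc zero)       zero             → pos-dot-product 0 0 1  1 0  b 0 (solve (b ∷ []))
  (suc zero)       (suc zero)       → pos-dot-product 1 0 a′ 1 1  b 0 (solve (a′ ∷ b ∷ []))
  (suc zero)       (suc (suc zero)) → pos-dot-product (b + b′) 0 c′ 1 b′ b 1 (solve (b ∷ b′ ∷ c′ ∷ []))
  (suc (suc zero)) zero             → pos-dot-product 0 0 1  0 0  1 0 refl
  (suc (suc zero)) (suc zero)       → pos-dot-product 0 0 a′ 0 1  1 0 refl
  (suc (suc zero)) (suc (suc zero)) → pos-dot-product 1 0 c′ 0 b′ 1 1 refl

letterCoords : Letter → Heisenberg
letterCoords X = 0 , 1 , 0
letterCoords Y = 1 , 0 , 0

letterMat≡unitriangular : ∀ w → letterMat w ≡ unitriangular (letterCoords w)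
letterMat≡unitriangular X = refl
letterMat≡unitriangular Y = refl

wordCoords : List Letter → Heisenberg
wordCoords []       = ε
wordCoords (w ∷ ws) = letterCoords w ∙ wordCoords ws

eval≈unitriangular : ∀ ws → eval ws ≈ unitriangular (wordCoords ws)
eval≈unitriangular []       i j = refl
eval≈unitriangular (w ∷ ws) i j = begin
  (letterMat w ⊗ eval ws) i j
    ≡⟨ ⊗-congʳ (letterMat w) (eval≈unitriangular ws) i j ⟩
  (letterMat w ⊗ unitriangular (wordCoords ws)) i j
    ≡⟨ cong (λ A → (A ⊗ unitriangular (wordCoords ws)) i j) (letterMat≡unitriangular w) ⟩
  (unitriangular (letterCoords w) ⊗ unitriangular (wordCoords ws)) i j
    ≡⟨ sym (unitriangular-∙ (letterCoords w) (wordCoords ws) i j) ⟩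
  unitriangular (wordCoords (w ∷ ws)) i j ∎

wordCoords-++ : ∀ us vs → wordCoords (us ++ vs) ≡ wordCoords us ∙ wordCoords vs
wordCoords-++ []       vs = refl
wordCoords-++ (u ∷ us) vs = begin
  letterCoords u ∙ wordCoords (us ++ vs)            ≡⟨ cong (letterCoords u ∙_) (wordCoords-++ us vs) ⟩
  letterCoords u ∙ (wordCoords us ∙ wordCoords vs)
    ≡⟨ sym (∙-assoc (letterCoords u) (wordCoords us) (wordCoords vs)) ⟩
  wordCoords (u ∷ us) ∙ wordCoords vs               ∎

wordCoords-YⁿX : ∀ n → wordCoords (replicate n Y ∷ʳ X) ≡ (n , 1 , n)
wordCoords-YⁿX zero    = refl
wordCoords-YⁿX (suc n) = cong (letterCoords Y ∙_) (wordCoords-YⁿX n)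

applyUpTo-+ : ∀ (f : ℕ → A) m n → applyUpTo f (m + n) ≡ applyUpTo f m ++ applyUpTo (λ t → f (m + t)) n
applyUpTo-+ f zero    n = refl
applyUpTo-+ f (suc m) n = cong (f 0 ∷_) (applyUpTo-+ (f ∘ suc) m n)

applyUpTo-cong : ∀ {f g : ℕ → A} n → (∀ {t} → t < n → f t ≡ g t) → applyUpTo f n ≡ applyUpTo g n
applyUpTo-cong zero    f≗g = refl
applyUpTo-cong (suc n) f≗g = cong₂ _∷_ (f≗g z<s) (applyUpTo-cong n (f≗g ∘ s<s))

applyUpTo-const : ∀ (x : A) n → applyUpTo (λ _ → x) n ≡ replicate n x
applyUpTo-const x zero    = refl
applyUpTo-const x (suc n) = cong (x ∷_) (applyUpTo-const x n)

largestPart-tail-≤ : ∀ {x xs} → Linked _≥_ (x ∷ xs) → largestPart xs ≤ x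
largestPart-tail-≤ Linked.[-]       = z≤n
largestPart-tail-≤ (x≥y Linked.∷ _) = x≥y

letterAt-∷ : ∀ x xs t →
  letterAt (x ∷ xs) t ≡ (if t ≡ᵇ x + length xs + 1 then X else letterAt xs t)
letterAt-∷ x xs t =
  trans (cong (λ b → if (t ≡ᵇ x + length xs + 1) ∨ b then X else Y) laterHooks)
        (if-∨ (t ≡ᵇ x + length xs + 1) _)
  where
  isHook : ℕ → Bool
  isHook k = t ≡ᵇ hook1 (x ∷ xs) (suc k) + 1

  laterHooks : or (map isHook (applyUpTo suc (length xs)))
             ≡ any (λ k → t ≡ᵇ hook1 xs (suc k) + 1) (upTo (length xs))
  laterHooks = cong or (trans (map-applyUpTo suc isHook (length xs))
                              (sym (map-upTo (isHook ∘ suc) (length xs))))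

  if-∨ : ∀ a b → (if a ∨ b then X else Y) ≡ (if a then X else if b then X else Y)
  if-∨ true  b = refl
  if-∨ false b = refl

letterAt-∷-hook : ∀ x xs → letterAt (x ∷ xs) (suc (x + length xs)) ≡ X
letterAt-∷-hook x xs = trans (letterAt-∷ x xs (suc (x + length xs)))
  (cong (λ b → if b then X else letterAt xs (suc (x + length xs)))
        (dec-true (_ ≟ _) (+-comm 1 (x + length xs))))

letterAt-∷-other : ∀ x xs {t} → t ≢ suc (x + length xs) → letterAt (x ∷ xs) t ≡ letterAt xs t
letterAt-∷-other x xs {t} t≢ = trans (letterAt-∷ x xs t)
  (cong (λ b → if b then X else letterAt xs t)
        (dec-false (_ ≟ _) (λ t≡ → t≢ (trans t≡ (+-comm (x + length xs) 1)))))

letterAt-beyond : ∀ {λs} → Linked _≥_ λs →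
  ∀ {t} → largestPart λs + length λs < t → letterAt λs t ≡ Y
letterAt-beyond {[]}     _      _     = refl
letterAt-beyond {x ∷ xs} sorted {t} x+ℓ<t = begin
  letterAt (x ∷ xs) t
    ≡⟨ letterAt-∷-other x xs (>⇒≢ (≤-<-trans (≤-reflexive (sym (+-suc x L))) x+ℓ<t)) ⟩
  letterAt xs t       ≡⟨ letterAt-beyond (Linked.tail sorted) (<-trans m+L<x+ℓ x+ℓ<t) ⟩
  Y                   ∎
  where
  L = length xs
  m+L<x+ℓ : largestPart xs + L < x + suc L
  m+L<x+ℓ = +-mono-≤-< (largestPart-tail-≤ sorted) (n<1+n L)

M-applyUpTo : ∀ λs → M λs ≡ applyUpTo (letterAt λs ∘ suc) (largestPart λs + length λs)
M-applyUpTo []       = refl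
M-applyUpTo (x ∷ xs) = trans (map-upTo (letterAt (x ∷ xs) ∘ suc) (x + length xs + 1))
  (cong (applyUpTo (letterAt (x ∷ xs) ∘ suc))
        (trans (+-comm (x + length xs) 1) (sym (+-suc x (length xs)))))

M-∷ : ∀ {x xs} → Linked _≥_ (x ∷ xs) →
  M (x ∷ xs) ≡ M xs ++ (replicate (x ∸ largestPart xs) Y ∷ʳ X)
M-∷ {x} {xs} sorted = begin
  M (x ∷ xs)                                    ≡⟨ M-applyUpTo (x ∷ xs) ⟩
  applyUpTo f (x + suc L)                       ≡⟨ cong (applyUpTo f) x+ℓ≡n+suc-d ⟩
  applyUpTo f (n + suc d)                       ≡⟨ applyUpTo-+ f n (suc d) ⟩
  applyUpTo f n ++ applyUpTo f[n+_] (suc d)     ≡⟨ cong (applyUpTo f n ++_) (sym (applyUpTo-∷ʳ f[n+_] d)) ⟩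
  applyUpTo f n ++ (applyUpTo f[n+_] d ∷ʳ f (n + d))
    ≡⟨ cong₂ (λ u v → u ++ v) prefix (cong₂ _∷ʳ_ run hook) ⟩
  M xs ++ (replicate d Y ∷ʳ X)                  ∎
  where
  L = length xs
  m = largestPart xs
  d = x ∸ m
  n = m + L
  f = letterAt (x ∷ xs) ∘ suc
  f[n+_] = λ t → f (n + t)

  n+d≡x+L : n + d ≡ x + L
  n+d≡x+L = begin
    m + L + d  ≡⟨ xy∙z≈xz∙y m L d ⟩
    m + d + L  ≡⟨ cong (_+ L) (m+[n∸m]≡n (largestPart-tail-≤ sorted)) ⟩
    x + L      ∎

  x+ℓ≡n+suc-d : x + suc L ≡ n + suc d
  x+ℓ≡n+suc-d = trans (+-suc x L) (trans (cong suc (sym n+d≡x+L)) (sym (+-suc n d)))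

  n≤x+L : n ≤ x + L
  n≤x+L = ≤-trans (m≤m+n n d) (≤-reflexive n+d≡x+L)

  prefix : applyUpTo f n ≡ M xs
  prefix = trans (applyUpTo-cong n (λ t<n → letterAt-∷-other x xs (<⇒≢ (s≤s (<-≤-trans t<n n≤x+L)))))
                 (sym (M-applyUpTo xs))

  run : applyUpTo f[n+_] d ≡ replicate d Y
  run = trans (applyUpTo-cong d inGap) (applyUpTo-const Y d)
    where
    inGap : ∀ {t} → t < d → f (n + t) ≡ Y
    inGap {t} t<d = begin
      f (n + t)                  ≡⟨ letterAt-∷-other x xs (<⇒≢ (s≤s n+t<x+L)) ⟩
      letterAt xs (suc (n + t))  ≡⟨ letterAt-beyond (Linked.tail sorted) (s≤s (m≤m+n n t)) ⟩
      Y                          ∎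
      where
      n+t<x+L : n + t < x + L
      n+t<x+L = <-≤-trans (+-monoʳ-< n t<d) (≤-reflexive n+d≡x+L)

  hook : f (n + d) ≡ X
  hook = trans (cong (letterAt (x ∷ xs) ∘ suc) n+d≡x+L) (letterAt-∷-hook x xs)

wordCoords-M : ∀ {λs} → Linked _≥_ λs → wordCoords (M λs) ≡ (largestPart λs , length λs , sum λs)
wordCoords-M {[]}     _      = refl
wordCoords-M {x ∷ xs} sorted = begin
  wordCoords (M (x ∷ xs))                              ≡⟨ cong wordCoords (M-∷ sorted) ⟩
  wordCoords (M xs ++ (replicate d Y ∷ʳ X))            ≡⟨ wordCoords-++ (M xs) (replicate d Y ∷ʳ X) ⟩
  wordCoords (M xs) ∙ wordCoords (replicate d Y ∷ʳ X)
    ≡⟨ cong₂ _∙_ (wordCoords-M (Linked.tail sorted)) (wordCoords-YⁿX d) ⟩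
  (m + d , L + 1 , sum xs + m * 1 + d)                 ≡⟨ cong₂ _,_ m+d≡x (cong₂ _,_ (+-comm L 1) corner) ⟩
  (x , suc L , x + sum xs)                             ∎
  where
  L = length xs
  m = largestPart xs
  d = x ∸ m

  m+d≡x : m + d ≡ x
  m+d≡x = m+[n∸m]≡n (largestPart-tail-≤ sorted)

  corner : sum xs + m * 1 + d ≡ x + sum xs
  corner = begin
    sum xs + m * 1 + d  ≡⟨ cong (λ k → sum xs + k + d) (*-identityʳ m) ⟩
    sum xs + m + d      ≡⟨ xy∙z≈yz∙x (sum xs) m d ⟩
    m + d + sum xs      ≡⟨ cong (_+ sum xs) m+d≡x ⟩
    x + sum xs          ∎

mainTheorem2 : (λs : List ℕ) → IsPartition λs →
    (i j : Fin 3) →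
    eval (M λs) i j
      ≡ mat (+ 1) (+ largestPart λs) (+ sum λs)
            (+ 0) (+ 1) (+ length λs)
            (+ 0) (+ 0) (+ 1) i j
mainTheorem2 λs (_ , sorted) i j = begin
  eval (M λs) i j
    ≡⟨ eval≈unitriangular (M λs) i j ⟩
  unitriangular (wordCoords (M λs)) i j
    ≡⟨ cong (λ p → unitriangular p i j) (wordCoords-M sorted) ⟩
  unitriangular (largestPart λs , length λs , sum λs) i j ∎
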